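{- Let $k_1,k_2\ge1$, let $C=\mathrm{Circ}(c_0,\dots,c_{k_1-1})$ and $D=\mathrm{Circ}(d_0,\dots,d_{k_2-1})$ be complex circulant matrices, and let $A=\begin{pmatrix} C & \mathbf{1}_{k_1,k_2}\\ \mathbf{1}_{k_2,k_1} & D\end{pmatrix}$, where $\mathbf{1}_{p,q}$ is the $p\times q$ all-ones matrix. Let $C_s=\sum_i c_i$, $D_s=\sum_i d_i$, $\overline{A}=\begin{pmatrix} C_s & k_2\\ k_1 & D_s\end{pmatrix}$, and suppose $\overline{A}$ is diagonalizable with (linearly independent) eigenvectors $(x_1,y_1)^T$ and $(x_2,y_2)^T$. Let $v_1=(x_1,\dots,x_1,y_1,\dots,y_1)^T$ and $v_2=(x_2,\dots,x_2,y_2,\dots,y_2)^T$ (first entry repeated $k_1$ times, second $k_2$ times). For $1\le j\le k_1-1$ let $w_j=(1,\omega_{k_1}^j,\dots,\omega_{k_1}^{(k_1-1)j},0,\dots,0)^T$ ($k_2$ trailing zeros), and for $1\le j\le k_2-1$ let $z_j=(0,\dots,0,1,\omega_{k_2}^j,\dots,\omega_{k_2}^{(k_2-1)j})^T$ ($k_1$ leading zeros). Then the system of eigenvectors $\{w_j\}_{j=1}^{k_1-1}\cup\{z_j\}_{j=1}^{k_2-1}\cup\{v_1,v_2\}$ of $A$ is linearly independent; in other words, $A$ is diagonalizable by these eigenvectors.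
   Context: $\mathrm{Circ}(c_0,\dots,c_{k-1})$ is the $k\times k$ matrix whose $(r,s)$ entry (indices $0,\dots,k-1$) is $c_{(r-s)\bmod k}$. $\omega_k$ denotes a fixed primitive $k$-th root of unity. -}

module Defs where

open import Level using (_⊔_)
open import Data.Nat as ℕ using (ℕ; zero; suc; _<_)
open import Data.Nat.DivMod using (_mod_)
open import Data.Fin as Fin using (Fin; toℕ; splitAt)
open import Data.Sum using (inj₁; inj₂)
open import Data.Product using (Σ; ∃; _×_)
open import Relation.Nullary using (¬_)
open import Algebra.Bundles using (CommutativeRing)

record Field (c ℓ : Level.Level) : Set (Level.suc (c ⊔ ℓ)) where
  field
    commRing : CommutativeRing c ℓ
  open CommutativeRing commRing public
  field
    0≉1     : ¬ (0# ≈ 1#)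
    inverse : ∀ x → ¬ (x ≈ 0#) → Σ Carrier (λ y → x * y ≈ 1#)

module LinAlg {c ℓ} (F : Field c ℓ) where
  open Field F

  pow : Carrier → ℕ → Carrier
  pow x zero    = 1#
  pow x (suc n) = x * pow x n

  fromℕ : ℕ → Carrier
  fromℕ zero    = 0#
  fromℕ (suc n) = 1# + fromℕ n

  Σ[_] : ∀ {n} → (Fin n → Carrier) → Carrier
  Σ[_] {zero}  f = 0#
  Σ[_] {suc n} f = f Fin.zero + Σ[ (λ i → f (Fin.suc i)) ]

  Matrix : ℕ → ℕ → Set c
  Matrix p q = Fin p → Fin q → Carrier

  Vector : ℕ → Set c
  Vector n = Fin n → Carrier

  _·_ : ∀ {p q} → Matrix p q → Vector q → Vector p
  (M · v) r = Σ[ (λ s → M r s * v s) ]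

  IsPrimitiveRoot : ℕ → Carrier → Set ℓ
  IsPrimitiveRoot k ω = (pow ω k ≈ 1#) × (∀ j → 0 < j → j < k → ¬ (pow ω j ≈ 1#))

  -- Circ(c_0,…,c_{k-1}) : (r,s) entry is c_{(r - s) mod k}; here k = suc m
  Circ : ∀ {m} → (Fin (suc m) → Carrier) → Matrix (suc m) (suc m)
  Circ {m} cs r s = cs ((toℕ r ℕ.+ (suc m ℕ.∸ toℕ s)) mod (suc m))

  block : ∀ {p q} → Matrix p p → Matrix q q → Matrix (p ℕ.+ q) (p ℕ.+ q)
  block {p} C D r s with splitAt p r | splitAt p s
  ... | inj₁ i | inj₁ j = C i j
  ... | inj₁ i | inj₂ j = 1#
  ... | inj₂ i | inj₁ j = 1#
  ... | inj₂ i | inj₂ j = D i j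

  rep : ∀ p q → Carrier → Carrier → Vector (p ℕ.+ q)
  rep p q x y r with splitAt p r
  ... | inj₁ _ = x
  ... | inj₂ _ = y

  wvec : ∀ p q → Carrier → ℕ → Vector (p ℕ.+ q)
  wvec p q ω j r with splitAt p r
  ... | inj₁ i = pow ω (toℕ i ℕ.* j)
  ... | inj₂ _ = 0#

  zvec : ∀ p q → Carrier → ℕ → Vector (p ℕ.+ q)
  zvec p q ω j r with splitAt p r
  ... | inj₁ _ = 0#
  ... | inj₂ i = pow ω (toℕ i ℕ.* j)

  IsEigenvector : ∀ {n} → Matrix n n → Vector n → Set (c ⊔ ℓ)
  IsEigenvector M v = (∃ λ r → ¬ (v r ≈ 0#)) × (∃ λ μ → ∀ r → (M · v) r ≈ μ * v r)

module Submission where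

-- Padded with zeros, the Fourier vectors (ω^(ij))ᵢ remain eigenvectors of A: they diagonalise
-- every circulant, and for j ≠ 0 (mod k) their entries sum to 0, so the all-ones blocks kill
-- them. Circulants have constant row sums, so a vector that is constant on the two blocks is
-- an eigenvector of A exactly when its pair of values is one of Ā. For independence, each
-- block of a vanishing combination is a vanishing discrete Fourier transform, which is
-- injective by the orthogonality relations Σᵢ ω^(i(j-s)) = k·[j = s] together with k ≠ 0 in F.

open import Defs
open import Data.Nat using (ℕ; suc)
open import Data.Fin using (Fin; toℕ)
open import Data.Product using (∃; _×_)

open import Data.Nat as ℕ using (zero; _<_; _≤_; _∸_; z≤n; s≤s)
import Data.Nat.Properties as ℕ
open import Data.Fin as Fin using (_↑ˡ_; _↑ʳ_; splitAt; inject₁; opposite; punchIn)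
import Data.Fin.Properties as Fin
import Data.Fin.Permutation as Perm
open import Data.Vec.Functional using (_∷_; removeAt)
open import Data.Nat.DivMod using (_mod_; [m+n]%n≡m%n; m<n⇒m%n≡m)
open import Data.Product using (_,_; proj₁; proj₂)
open import Data.Sum using (inj₁; inj₂)
open import Function using (_∘_)
open import Relation.Nullary using (¬_)
open import Relation.Binary.Definitions using (tri<; tri≈; tri>)
open import Relation.Binary.PropositionalEquality as ≡ using (_≡_; _≢_)
import Algebra.Properties.Ring as RingProperties
import Algebra.Properties.Semiring.Sum as SemiringSum
import Algebra.Properties.CommutativeSemiring.Exp as CommutativeSemiringExp
import Algebra.Properties.Semiring.Divisibility as SemiringDivisibility
import Algebra.Properties.CommutativeSemigroup as CommutativeSemigroupProperties

module BlockCirculant {ℓ₁ ℓ₂} (F : Field ℓ₁ ℓ₂) where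
  open Field F hiding (zero)
  open LinAlg F
  open RingProperties ring using (-1*x≈-x; x∙y⁻¹≈ε⇒x≈y; +-cancelˡ)
  open SemiringSum semiring
  open CommutativeSemiringExp commutativeSemiring
  open SemiringDivisibility semiring using (_∣_; _∣0; ∣-refl; ∣ʳ-respʳ-≈; x∣ʳy⇒x∣ʳzy; x∣y∧y≉0⇒x≉0)
  open CommutativeSemigroupProperties *-commutativeSemigroup using (x∙yz≈y∙xz; x∙yz≈z∙xy)
  open import Algebra.Definitions.RawMagma *-rawMagma using (_,_)
  open import Relation.Binary.Reasoning.Setoid setoid

  x*y≈0⇒y≈0 : ∀ {x y} → x ≉ 0# → x * y ≈ 0# → y ≈ 0#
  x*y≈0⇒y≈0 {x} {y} x≉0 xy≈0 with inverse x x≉0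
  ... | x⁻¹ , xx⁻¹≈1 = begin
    y              ≈⟨ *-identityˡ y ⟨
    1# * y         ≈⟨ *-congʳ xx⁻¹≈1 ⟨
    (x * x⁻¹) * y  ≈⟨ *-congʳ (*-comm x x⁻¹) ⟩
    (x⁻¹ * x) * y  ≈⟨ *-assoc x⁻¹ x y ⟩
    x⁻¹ * (x * y)  ≈⟨ *-congˡ xy≈0 ⟩
    x⁻¹ * 0#       ≈⟨ zeroʳ x⁻¹ ⟩
    0#             ∎

  *-preserves-≉0 : ∀ {x y} → x ≉ 0# → y ≉ 0# → x * y ≉ 0#
  *-preserves-≉0 x≉0 y≉0 xy≈0 = y≉0 (x*y≈0⇒y≈0 x≉0 xy≈0)

  1≉0 : 1# ≉ 0#
  1≉0 1≈0 = 0≉1 (sym 1≈0)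

  x≉y⇒x-y≉0 : ∀ {x y} → x ≉ y → x + - y ≉ 0#
  x≉y⇒x-y≉0 {x} {y} x≉y x-y≈0 = x≉y (x∙y⁻¹≈ε⇒x≈y x y x-y≈0)

  Σ≡sum : ∀ {n} (f : Fin n → Carrier) → Σ[ f ] ≡ sum f
  Σ≡sum {zero}  f = ≡.refl
  Σ≡sum {suc n} f = ≡.cong (f Fin.zero +_) (Σ≡sum (f ∘ Fin.suc))

  pow≡^ : ∀ x n → pow x n ≡ x ^ n
  pow≡^ x zero    = ≡.refl
  pow≡^ x (suc n) = ≡.cong (x *_) (pow≡^ x n)

  Σ≈sum : ∀ {n} (f : Fin n → Carrier) {g} → (∀ i → f i ≈ g i) → Σ[ f ] ≈ sum g
  Σ≈sum f f≈g = trans (reflexive (Σ≡sum f)) (sum-cong-≋ f≈g)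

  ·≈sum : ∀ {p q} (M : Matrix p q) v r → (M · v) r ≈ ∑[ s < q ] (M r s * v s)
  ·≈sum M v r = reflexive (Σ≡sum (λ s → M r s * v s))

  sum-const : ∀ n x → ∑[ i < n ] x ≈ fromℕ n * x
  sum-const zero    x = sym (zeroˡ x)
  sum-const (suc n) x = begin
    x + ∑[ i < n ] x         ≈⟨ +-congˡ (sum-const n x) ⟩
    x + fromℕ n * x          ≈⟨ +-congʳ (*-identityˡ x) ⟨
    1# * x + fromℕ n * x     ≈⟨ distribʳ x 1# (fromℕ n) ⟨
    (1# + fromℕ n) * x       ∎

  ^-swap : ∀ x a b → (x ^ a) ^ b ≈ (x ^ b) ^ a
  ^-swap x a b = begin
    (x ^ a) ^ b    ≈⟨ ^-assocʳ x a b ⟩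
    x ^ (a ℕ.* b)  ≡⟨ ≡.cong (x ^_) (ℕ.*-comm a b) ⟩
    x ^ (b ℕ.* a)  ≈⟨ ^-assocʳ x b a ⟨
    (x ^ b) ^ a    ∎

  ^-≈1 : ∀ {x} n → x ≈ 1# → x ^ n ≈ 1#
  ^-≈1 zero    x≈1 = refl
  ^-≈1 (suc n) x≈1 = trans (*-cong x≈1 (^-≈1 n x≈1)) (*-identityʳ 1#)

  sum-rotate : ∀ n (f : ℕ → Carrier) → f n ≈ f 0 →
               ∑[ i < n ] f (suc (toℕ i)) ≈ ∑[ i < n ] f (toℕ i)
  sum-rotate n f fn≈f0 = +-cancelˡ (f 0) _ _ (begin
    f 0 + ∑[ i < n ] f (suc (toℕ i))                      ≈⟨ sum-init-last (f ∘ toℕ) ⟩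
    ∑[ i < n ] f (toℕ (inject₁ i)) + f (toℕ (Fin.fromℕ n))
      ≡⟨ ≡.cong₂ _+_ (sum-cong-≗ {n} (≡.cong f ∘ Fin.toℕ-inject₁)) (≡.cong f (Fin.toℕ-fromℕ n)) ⟩
    ∑[ i < n ] f (toℕ i) + f n                             ≈⟨ +-congˡ fn≈f0 ⟩
    ∑[ i < n ] f (toℕ i) + f 0                             ≈⟨ +-comm _ _ ⟩
    f 0 + ∑[ i < n ] f (toℕ i)                             ∎)

  power-sum-≉1 : ∀ n {x} → x ^ n ≈ 1# → x ≉ 1# → ∑[ i < n ] (x ^ toℕ i) ≈ 0#
  power-sum-≉1 n {x} xⁿ≈1 x≉1 = x*y≈0⇒y≈0 (x≉y⇒x-y≉0 x≉1) (begin
    (x + - 1#) * G    ≈⟨ distribʳ G x (- 1#) ⟩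
    x * G + - 1# * G  ≈⟨ +-cong xG≈G (-1*x≈-x G) ⟩
    G + - G           ≈⟨ -‿inverseʳ G ⟩
    0#                ∎)
    where
    G = ∑[ i < n ] (x ^ toℕ i)
    xG≈G : x * G ≈ G
    xG≈G = trans (*-distribˡ-sum {n} x (λ i → x ^ toℕ i)) (sum-rotate n (x ^_) xⁿ≈1)

  power-sum-≈1 : ∀ n {x} → x ≈ 1# → ∑[ i < n ] (x ^ toℕ i) ≈ fromℕ n
  power-sum-≈1 n x≈1 = begin
    ∑[ i < n ] _ ≈⟨ sum-cong-≋ {n} (λ i → ^-≈1 (toℕ i) x≈1) ⟩
    ∑[ i < n ] 1# ≈⟨ sum-const n 1# ⟩
    fromℕ n * 1#  ≈⟨ *-identityʳ _ ⟩
    fromℕ n       ∎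

  ∣-+ : ∀ {x y z} → x ∣ y → x ∣ z → x ∣ y + z
  ∣-+ {x} (p , px≈y) (q , qx≈z) = p + q , trans (distribʳ x p q) (+-cong px≈y qx≈z)

  sum-δ : ∀ {n} (f : Fin (suc n) → Carrier) s → (∀ j → j ≢ s → f j ≈ 0#) →
          ∑[ j < suc n ] f j ≈ f s
  sum-δ {n} f s f≈0 = begin
    sum f                     ≈⟨ sum-remove {i = s} f ⟩
    f s + sum (removeAt f s)  ≈⟨ +-congˡ (sum-cong-≋ {n} (λ j → f≈0 (punchIn s j) (Fin.punchInᵢ≢i s j))) ⟩
    f s + ∑[ j < n ] 0#       ≈⟨ +-congˡ (sum-replicate-zero n) ⟩
    f s + 0#                  ≈⟨ +-identityʳ (f s) ⟩
    f s                       ∎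

  module RootOfUnity {m : ℕ} {ω : Carrier} (prim : IsPrimitiveRoot (suc m) ω) where

    ω^k≈1 : ω ^ suc m ≈ 1#
    ω^k≈1 = trans (reflexive (≡.sym (pow≡^ ω (suc m)))) (proj₁ prim)

    ω^j≉1 : ∀ {j} → 0 < j → j < suc m → ω ^ j ≉ 1#
    ω^j≉1 {j} 0<j j<k ωʲ≈1 = proj₂ prim j 0<j j<k (trans (reflexive (pow≡^ ω j)) ωʲ≈1)

    [ω^j]^k≈1 : ∀ j → (ω ^ j) ^ suc m ≈ 1#
    [ω^j]^k≈1 j = trans (^-swap ω j (suc m)) (^-≈1 j ω^k≈1)

    -- Summed over the k-th roots of unity, a polynomial of degree < k gives k times its constant
    -- term. For the vanishing polynomial of ω, …, ω^m the sum is its value at 1, which is nonzero.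
    vanishing : ℕ → Carrier → Carrier
    vanishing zero    y = 1#
    vanishing (suc d) y = (y + - (ω ^ suc d)) * vanishing d y

    vanishing-root : ∀ {d j} → 0 < j → j ≤ d → vanishing d (ω ^ j) ≈ 0#
    vanishing-root {zero}  {suc _} _   ()
    vanishing-root {suc d} {j}     0<j j≤1+d with ℕ.m≤n⇒m<n∨m≡n j≤1+d
    ... | inj₁ j<1+d   = trans (*-congˡ (vanishing-root 0<j (ℕ.s≤s⁻¹ j<1+d))) (zeroʳ _)
    ... | inj₂ ≡.refl = trans (*-congʳ (-‿inverseʳ (ω ^ j))) (zeroˡ _)

    vanishing-1≉0 : ∀ {d} → d < suc m → vanishing d 1# ≉ 0#
    vanishing-1≉0 {zero}  _     = 1≉0
    vanishing-1≉0 {suc d} 1+d<k = *-preserves-≉0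
      (x≉y⇒x-y≉0 (λ 1≈ω^j → ω^j≉1 (s≤s z≤n) 1+d<k (sym 1≈ω^j)))
      (vanishing-1≉0 (ℕ.<-trans (ℕ.n<1+n d) 1+d<k))

    K∣power-sum : ∀ {n} → n < suc m → fromℕ (suc m) ∣ ∑[ i < suc m ] ((ω ^ n) ^ toℕ i)
    K∣power-sum {zero}  _   = ∣ʳ-respʳ-≈ (sym (power-sum-≈1 (suc m) refl)) ∣-refl
    K∣power-sum {suc n} n<k = ∣ʳ-respʳ-≈ (sym (power-sum-≉1 (suc m) ([ω^j]^k≈1 (suc n)) (ω^j≉1 (s≤s z≤n) n<k)))
                                        (fromℕ (suc m) ∣0)

    K∣∑monomial*vanishing : ∀ n d → n ℕ.+ d < suc m →
      fromℕ (suc m) ∣ ∑[ i < suc m ] ((ω ^ toℕ i) ^ n * vanishing d (ω ^ toℕ i))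
    K∣∑monomial*vanishing n zero n+0<k = ∣ʳ-respʳ-≈
      (sum-cong-≋ {suc m} (λ i → sym (trans (*-identityʳ _) (^-swap ω (toℕ i) n))))
      (K∣power-sum (≡.subst (_< suc m) (ℕ.+-identityʳ n) n+0<k))
    K∣∑monomial*vanishing n (suc d) n+1+d<k = ∣ʳ-respʳ-≈ (sym (begin
      ∑[ i < suc m ] ((ω ^ toℕ i) ^ n * vanishing (suc d) (ω ^ toℕ i))
        ≈⟨ sum-cong-≋ {suc m} (λ i → expand (ω ^ toℕ i)) ⟩
      ∑[ i < suc m ] (g (suc n) i + a * g n i)
        ≈⟨ ∑-distrib-+ (g (suc n)) (λ i → a * g n i) ⟩
      sum (g (suc n)) + ∑[ i < suc m ] (a * g n i)
        ≈⟨ +-congˡ (*-distribˡ-sum a (g n)) ⟨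
      sum (g (suc n)) + a * sum (g n)
        ∎))
      (∣-+ (K∣∑monomial*vanishing (suc n) d (≡.subst (_< suc m) (ℕ.+-suc n d) n+1+d<k))
           (x∣ʳy⇒x∣ʳzy a (K∣∑monomial*vanishing n d (ℕ.<-trans (ℕ.+-monoʳ-< n (ℕ.n<1+n d)) n+1+d<k))))
      where
      a = - (ω ^ suc d)
      g : ℕ → Fin (suc m) → Carrier
      g e i = (ω ^ toℕ i) ^ e * vanishing d (ω ^ toℕ i)
      expand : ∀ y → y ^ n * ((y + a) * vanishing d y) ≈ y ^ suc n * vanishing d y + a * (y ^ n * vanishing d y)
      expand y = begin
        y ^ n * ((y + a) * vanishing d y)                   ≈⟨ x∙yz≈y∙xz (y ^ n) (y + a) (vanishing d y) ⟩
        (y + a) * (y ^ n * vanishing d y)                   ≈⟨ distribʳ _ y a ⟩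
        y * (y ^ n * vanishing d y) + a * (y ^ n * vanishing d y) ≈⟨ +-congʳ (*-assoc y (y ^ n) _) ⟨
        y ^ suc n * vanishing d y + a * (y ^ n * vanishing d y)   ∎

    ∑vanishing≈vanishing-1 : ∑[ i < suc m ] (1# * vanishing m (ω ^ toℕ i)) ≈ vanishing m 1#
    ∑vanishing≈vanishing-1 = begin
      ∑[ i < suc m ] (1# * vanishing m (ω ^ toℕ i))
        ≡⟨⟩
      1# * vanishing m 1# + ∑[ i < m ] (1# * vanishing m (ω ^ suc (toℕ i)))
        ≈⟨ +-cong (*-identityˡ _) (sum-cong-≋ {m} (λ i →
             trans (*-identityˡ _) (vanishing-root (s≤s z≤n) (Fin.toℕ<n i)))) ⟩
      vanishing m 1# + ∑[ i < m ] 0#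
        ≈⟨ +-congˡ (sum-replicate-zero m) ⟩
      vanishing m 1# + 0#
        ≈⟨ +-identityʳ _ ⟩
      vanishing m 1#
        ∎

    K≉0 : fromℕ (suc m) ≉ 0#
    K≉0 = x∣y∧y≉0⇒x≉0 (K∣∑monomial*vanishing 0 m ℕ.≤-refl)
                      (λ ∑≈0 → vanishing-1≉0 ℕ.≤-refl (trans (sym ∑vanishing≈vanishing-1) ∑≈0))

    s+[k∸s]≡k : ∀ (s : Fin (suc m)) → toℕ s ℕ.+ (suc m ∸ toℕ s) ≡ suc m
    s+[k∸s]≡k s = ℕ.m+[n∸m]≡n (ℕ.<⇒≤ (Fin.toℕ<n s))

    ω^[j+k∸s]≉1 : ∀ {j s : Fin (suc m)} → j ≢ s → ω ^ (toℕ j ℕ.+ (suc m ∸ toℕ s)) ≉ 1#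
    ω^[j+k∸s]≉1 {j} {s} j≢s with ℕ.<-cmp (toℕ j) (toℕ s)
    ... | tri≈ _ j≡s _ = λ _ → j≢s (Fin.toℕ-injective j≡s)
    ... | tri< j<s _ _ = ω^j≉1 0<e e<k
      where
      0<e : 0 < toℕ j ℕ.+ (suc m ∸ toℕ s)
      0<e = ℕ.<-≤-trans (ℕ.m<n⇒0<n∸m (Fin.toℕ<n s)) (ℕ.m≤n+m _ (toℕ j))
      e<k : toℕ j ℕ.+ (suc m ∸ toℕ s) < suc m
      e<k = ≡.subst (toℕ j ℕ.+ (suc m ∸ toℕ s) <_) (s+[k∸s]≡k s) (ℕ.+-monoˡ-< (suc m ∸ toℕ s) j<s)
    ... | tri> _ _ s<j = λ ω^e≈1 → ω^j≉1 (ℕ.m<n⇒0<n∸m s<j) d<k (begin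
      ω ^ d                      ≈⟨ *-identityʳ _ ⟨
      ω ^ d * 1#                 ≈⟨ *-congˡ ω^k≈1 ⟨
      ω ^ d * ω ^ suc m          ≈⟨ ^-homo-* ω d (suc m) ⟨
      ω ^ (d ℕ.+ suc m)          ≡⟨ ≡.cong (ω ^_) e≡d+k ⟨
      ω ^ (toℕ j ℕ.+ (suc m ∸ toℕ s)) ≈⟨ ω^e≈1 ⟩
      1#                         ∎)
      where
      d = toℕ j ∸ toℕ s
      d<k : d < suc m
      d<k = ℕ.≤-<-trans (ℕ.m∸n≤m (toℕ j) (toℕ s)) (Fin.toℕ<n j)
      e≡d+k : toℕ j ℕ.+ (suc m ∸ toℕ s) ≡ d ℕ.+ suc m
      e≡d+k = ≡.trans (≡.cong (ℕ._+ (suc m ∸ toℕ s))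
                                (≡.trans (≡.sym (ℕ.m+[n∸m]≡n (ℕ.<⇒≤ s<j))) (ℕ.+-comm (toℕ s) d)))
                      (≡.trans (ℕ.+-assoc d (toℕ s) _) (≡.cong (d ℕ.+_) (s+[k∸s]≡k s)))

    power-sum-off-diagonal : ∀ {j s : Fin (suc m)} → j ≢ s →
                 ∑[ i < suc m ] ((ω ^ (toℕ j ℕ.+ (suc m ∸ toℕ s))) ^ toℕ i) ≈ 0#
    power-sum-off-diagonal {j} {s} j≢s =
      power-sum-≉1 (suc m) ([ω^j]^k≈1 (toℕ j ℕ.+ (suc m ∸ toℕ s))) (ω^[j+k∸s]≉1 j≢s)

    power-sum-diagonal : ∀ (s : Fin (suc m)) →
                  ∑[ i < suc m ] ((ω ^ (toℕ s ℕ.+ (suc m ∸ toℕ s))) ^ toℕ i) ≈ fromℕ (suc m)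
    power-sum-diagonal s = power-sum-≈1 (suc m) (trans (reflexive (≡.cong (ω ^_) (s+[k∸s]≡k s))) ω^k≈1)

    dft-injective : ∀ (f : Fin (suc m) → Carrier) →
                    (∀ i → ∑[ j < suc m ] (f j * (ω ^ toℕ i) ^ toℕ j) ≈ 0#) → ∀ s → f s ≈ 0#
    dft-injective f f̂≈0 s = x*y≈0⇒y≈0 K≉0 (begin
      fromℕ k * f s
        ≈⟨ *-comm _ (f s) ⟩
      f s * fromℕ k
        ≈⟨ *-congˡ (power-sum-diagonal s) ⟨
      f s * P s
        ≈⟨ sum-δ {m} (λ j → f j * P j) s (λ j j≢s → trans (*-congˡ (power-sum-off-diagonal j≢s)) (zeroʳ (f j))) ⟨
      ∑[ j < k ] (f j * P j)
        ≈⟨ sum-cong-≋ {k} (λ j → *-distribˡ-sum {k} (f j) (λ i → (ω ^ e j) ^ toℕ i)) ⟩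
      ∑[ j < k ] ∑[ i < k ] (f j * (ω ^ e j) ^ toℕ i)
        ≈⟨ ∑-comm {k} {k} (λ j i → f j * (ω ^ e j) ^ toℕ i) ⟩
      ∑[ i < k ] ∑[ j < k ] (f j * (ω ^ e j) ^ toℕ i)
        ≈⟨ sum-cong-≋ {k} (λ i → trans (sum-cong-≋ {k} (twist i)) (sym (*-distribˡ-sum (r i) (f̂ i)))) ⟩
      ∑[ i < k ] (r i * sum (f̂ i))
        ≈⟨ sum-cong-≋ {k} (λ i → trans (*-congˡ (f̂≈0 i)) (zeroʳ (r i))) ⟩
      ∑[ i < k ] 0#
        ≈⟨ sum-replicate-zero k ⟩
      0#
        ∎)
      where
      k = suc m
      -- The factor ω^(i(k ∸ s)) plays the role of ω^(-is).
      e : Fin k → ℕ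
      e j = toℕ j ℕ.+ (k ∸ toℕ s)
      P : Fin k → Carrier
      P j = ∑[ i < k ] ((ω ^ e j) ^ toℕ i)
      r : Fin k → Carrier
      r i = (ω ^ toℕ i) ^ (k ∸ toℕ s)
      f̂ : Fin k → Fin k → Carrier
      f̂ i j = f j * (ω ^ toℕ i) ^ toℕ j
      twist : ∀ i j → f j * (ω ^ e j) ^ toℕ i ≈ r i * f̂ i j
      twist i j = begin
        f j * (ω ^ e j) ^ toℕ i                ≈⟨ *-congˡ (^-swap ω (e j) (toℕ i)) ⟩
        f j * (ω ^ toℕ i) ^ e j                ≈⟨ *-congˡ (^-homo-* (ω ^ toℕ i) (toℕ j) (k ∸ toℕ s)) ⟩
        f j * ((ω ^ toℕ i) ^ toℕ j * r i)      ≈⟨ x∙yz≈z∙xy (f j) _ _ ⟩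
        r i * f̂ i j                            ∎

  module Circulant {m : ℕ} (cs : Fin (suc m) → Carrier) where

    -- The periodic extension of cs, so that Circ cs r s is c (r + (k ∸ s)) by definition.
    c : ℕ → Carrier
    c n = cs (n mod suc m)

    c-periodic : ∀ n → c (n ℕ.+ suc m) ≡ c n
    c-periodic n = ≡.cong cs (Fin.toℕ-injective (≡.trans (Fin.toℕ-fromℕ< _)
                     (≡.trans ([m+n]%n≡m%n n (suc m)) (≡.sym (Fin.toℕ-fromℕ< _)))))

    c-toℕ : ∀ i → c (toℕ i) ≡ cs i
    c-toℕ i = ≡.cong cs (Fin.toℕ-injective (≡.trans (Fin.toℕ-fromℕ< _) (m<n⇒m%n≡m (Fin.toℕ<n i))))

    row : Carrier → ℕ → Carrier
    row x r = ∑[ s < suc m ] (c (r ℕ.+ (suc m ∸ toℕ s)) * x ^ toℕ s)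

    eigenvalue : Carrier → Carrier
    eigenvalue x = row x 0

    row-suc : ∀ {x} → x ^ suc m ≈ 1# → ∀ r → row x (suc r) ≈ x * row x r
    row-suc {x} xᵏ≈1 r = begin
      ∑[ s < suc m ] g (toℕ s)
        ≈⟨ sum-rotate (suc m) g gₖ≈g₀ ⟨
      ∑[ s < suc m ] g (suc (toℕ s))
        ≈⟨ sum-cong-≋ {suc m} (λ s → shift (Fin.toℕ<n s)) ⟩
      ∑[ s < suc m ] (x * (c (r ℕ.+ (suc m ∸ toℕ s)) * x ^ toℕ s))
        ≈⟨ *-distribˡ-sum {suc m} x (λ s → c (r ℕ.+ (suc m ∸ toℕ s)) * x ^ toℕ s) ⟨
      x * row x r
        ∎
      where
      g : ℕ → Carrier
      g n = c (suc r ℕ.+ (suc m ∸ n)) * x ^ n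
      gₖ≈g₀ : g (suc m) ≈ g 0
      gₖ≈g₀ = *-cong (reflexive (≡.trans (≡.cong (λ n → c (suc r ℕ.+ n)) (ℕ.n∸n≡0 m))
                                          (≡.trans (≡.cong c (ℕ.+-identityʳ (suc r))) (≡.sym (c-periodic (suc r))))))
                     xᵏ≈1
      shift : ∀ {s} → s < suc m → g (suc s) ≈ x * (c (r ℕ.+ (suc m ∸ s)) * x ^ s)
      shift {s} s<k = begin
        c (suc r ℕ.+ (m ∸ s)) * (x * x ^ s)  ≡⟨ ≡.cong (λ n → c n * (x * x ^ s)) index ⟩
        c (r ℕ.+ (suc m ∸ s)) * (x * x ^ s)  ≈⟨ x∙yz≈y∙xz _ x (x ^ s) ⟩
        x * (c (r ℕ.+ (suc m ∸ s)) * x ^ s)  ∎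
        where
        index : suc r ℕ.+ (m ∸ s) ≡ r ℕ.+ (suc m ∸ s)
        index = ≡.trans (≡.sym (ℕ.+-suc r (m ∸ s))) (≡.cong (r ℕ.+_) (≡.sym (ℕ.+-∸-assoc 1 (ℕ.s≤s⁻¹ s<k))))

    row≈x^r*eigenvalue : ∀ {x} → x ^ suc m ≈ 1# → ∀ r → row x r ≈ x ^ r * eigenvalue x
    row≈x^r*eigenvalue xᵏ≈1 zero    = sym (*-identityˡ _)
    row≈x^r*eigenvalue {x} xᵏ≈1 (suc r) = begin
      row x (suc r)                  ≈⟨ row-suc xᵏ≈1 r ⟩
      x * row x r                    ≈⟨ *-congˡ (row≈x^r*eigenvalue xᵏ≈1 r) ⟩
      x * (x ^ r * eigenvalue x)     ≈⟨ *-assoc x (x ^ r) _ ⟨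
      x ^ suc r * eigenvalue x       ∎

    Circ-eigen : ∀ {x} → x ^ suc m ≈ 1# → ∀ r →
                 ∑[ s < suc m ] (Circ cs r s * x ^ toℕ s) ≈ eigenvalue x * x ^ toℕ r
    Circ-eigen xᵏ≈1 r = trans (row≈x^r*eigenvalue xᵏ≈1 (toℕ r)) (*-comm _ _)

    Circ-row-sum : ∀ r → ∑[ s < suc m ] Circ cs r s ≈ Σ[ cs ]
    Circ-row-sum r = begin
      ∑[ s < suc m ] Circ cs r s
        ≈⟨ sum-cong-≋ {suc m} (λ s → sym (x*1^n≈x {Circ cs r s} (toℕ s))) ⟩
      ∑[ s < suc m ] (Circ cs r s * 1# ^ toℕ s)
        ≈⟨ Circ-eigen (^-≈1 (suc m) refl) r ⟩
      eigenvalue 1# * 1# ^ toℕ r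
        ≈⟨ x*1^n≈x (toℕ r) ⟩
      eigenvalue 1#
        ≈⟨ sum-cong-≋ {suc m} (λ s → x*1^n≈x {c (suc m ∸ toℕ s)} (toℕ s)) ⟩
      ∑[ s < suc m ] h (toℕ s)
        ≈⟨ sum-rotate (suc m) h hₖ≈h₀ ⟨
      ∑[ s < suc m ] c (suc m ∸ suc (toℕ s))
        ≡⟨ sum-cong-≗ {suc m} (λ s → ≡.cong c (Fin.opposite-prop s)) ⟨
      ∑[ s < suc m ] c (toℕ (opposite s))
        ≈⟨ ∑-permute {suc m} (c ∘ toℕ) Perm.reverse ⟨
      ∑[ s < suc m ] c (toℕ s)
        ≡⟨ sum-cong-≗ {suc m} c-toℕ ⟩
      sum cs
        ≡⟨ Σ≡sum cs ⟨
      Σ[ cs ]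
        ∎
      where
      x*1^n≈x : ∀ {y} n → y * 1# ^ n ≈ y
      x*1^n≈x n = trans (*-congˡ (^-≈1 n refl)) (*-identityʳ _)
      h : ℕ → Carrier
      h n = c (suc m ∸ n)
      hₖ≈h₀ : h (suc m) ≈ h 0
      hₖ≈h₀ = reflexive (≡.trans (≡.cong c (ℕ.n∸n≡0 m)) (≡.sym (c-periodic 0)))

  ↑-elim : ∀ {p q b} (P : Fin (p ℕ.+ q) → Set b) →
           (∀ i → P (i ↑ˡ q)) → (∀ j → P (p ↑ʳ j)) → ∀ r → P r
  ↑-elim {p} {q} P left right r with splitAt p r | Fin.join-splitAt p q r
  ... | inj₁ i | ≡.refl = left i
  ... | inj₂ j | ≡.refl = right j

  sum-↑ : ∀ p {q} (f : Fin (p ℕ.+ q) → Carrier) →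
          sum f ≈ ∑[ i < p ] f (i ↑ˡ q) + ∑[ j < q ] f (p ↑ʳ j)
  sum-↑ zero    f = sym (+-identityˡ _)
  sum-↑ (suc p) f = trans (+-congˡ (sum-↑ p (f ∘ Fin.suc))) (sym (+-assoc _ _ _))

  module _ {p q : ℕ} (C : Matrix p p) (D : Matrix q q) where

    block-↑ˡ-↑ˡ : ∀ i j → block C D (i ↑ˡ q) (j ↑ˡ q) ≡ C i j
    block-↑ˡ-↑ˡ i j rewrite Fin.splitAt-↑ˡ p i q | Fin.splitAt-↑ˡ p j q = ≡.refl

    block-↑ˡ-↑ʳ : ∀ i j → block C D (i ↑ˡ q) (p ↑ʳ j) ≡ 1#
    block-↑ˡ-↑ʳ i j rewrite Fin.splitAt-↑ˡ p i q | Fin.splitAt-↑ʳ p q j = ≡.refl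

    block-↑ʳ-↑ˡ : ∀ i j → block C D (p ↑ʳ i) (j ↑ˡ q) ≡ 1#
    block-↑ʳ-↑ˡ i j rewrite Fin.splitAt-↑ʳ p q i | Fin.splitAt-↑ˡ p j q = ≡.refl

    block-↑ʳ-↑ʳ : ∀ i j → block C D (p ↑ʳ i) (p ↑ʳ j) ≡ D i j
    block-↑ʳ-↑ʳ i j rewrite Fin.splitAt-↑ʳ p q i | Fin.splitAt-↑ʳ p q j = ≡.refl

    block·-↑ˡ : ∀ v i → (block C D · v) (i ↑ˡ q) ≈
                ∑[ s < p ] (C i s * v (s ↑ˡ q)) + ∑[ s < q ] v (p ↑ʳ s)
    block·-↑ˡ v i = trans (·≈sum (block C D) v (i ↑ˡ q)) (trans (sum-↑ p _)
      (+-cong (sum-cong-≋ {p} (λ s → *-congʳ (reflexive (block-↑ˡ-↑ˡ i s))))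
              (sum-cong-≋ {q} (λ s → trans (*-congʳ (reflexive (block-↑ˡ-↑ʳ i s))) (*-identityˡ _)))))

    block·-↑ʳ : ∀ v j → (block C D · v) (p ↑ʳ j) ≈
                ∑[ s < p ] v (s ↑ˡ q) + ∑[ s < q ] (D j s * v (p ↑ʳ s))
    block·-↑ʳ v j = trans (·≈sum (block C D) v (p ↑ʳ j)) (trans (sum-↑ p _)
      (+-cong (sum-cong-≋ {p} (λ s → trans (*-congʳ (reflexive (block-↑ʳ-↑ˡ j s))) (*-identityˡ _)))
              (sum-cong-≋ {q} (λ s → *-congʳ (reflexive (block-↑ʳ-↑ʳ j s))))))

    block-eigen : ∀ v μ →
      (∀ i → ∑[ s < p ] (C i s * v (s ↑ˡ q)) + ∑[ s < q ] v (p ↑ʳ s) ≈ μ * v (i ↑ˡ q)) →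
      (∀ j → ∑[ s < p ] v (s ↑ˡ q) + ∑[ s < q ] (D j s * v (p ↑ʳ s)) ≈ μ * v (p ↑ʳ j)) →
      ∀ r → (block C D · v) r ≈ μ * v r
    block-eigen v μ top bottom = ↑-elim (λ r → (block C D · v) r ≈ μ * v r)
      (λ i → trans (block·-↑ˡ v i) (top i))
      (λ j → trans (block·-↑ʳ v j) (bottom j))

  pow[a*b]≈[x^b]^a : ∀ x a b → pow x (a ℕ.* b) ≈ (x ^ b) ^ a
  pow[a*b]≈[x^b]^a x a b = trans (reflexive (pow≡^ x (a ℕ.* b))) (trans (sym (^-assocʳ x a b)) (^-swap x a b))

  module _ {p q : ℕ} where

    rep-↑ˡ : ∀ {x y} i → rep p q x y (i ↑ˡ q) ≡ x
    rep-↑ˡ i rewrite Fin.splitAt-↑ˡ p i q = ≡.refl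

    rep-↑ʳ : ∀ {x y} i → rep p q x y (p ↑ʳ i) ≡ y
    rep-↑ʳ i rewrite Fin.splitAt-↑ʳ p q i = ≡.refl

    wvec-↑ˡ : ∀ {ω j} i → wvec p q ω j (i ↑ˡ q) ≈ (ω ^ j) ^ toℕ i
    wvec-↑ˡ {ω} {j} i rewrite Fin.splitAt-↑ˡ p i q = pow[a*b]≈[x^b]^a ω (toℕ i) j

    wvec-↑ʳ : ∀ {ω j} i → wvec p q ω j (p ↑ʳ i) ≡ 0#
    wvec-↑ʳ i rewrite Fin.splitAt-↑ʳ p q i = ≡.refl

    zvec-↑ˡ : ∀ {ω j} i → zvec p q ω j (i ↑ˡ q) ≡ 0#
    zvec-↑ˡ i rewrite Fin.splitAt-↑ˡ p i q = ≡.refl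

    zvec-↑ʳ : ∀ {ω j} i → zvec p q ω j (p ↑ʳ i) ≈ (ω ^ j) ^ toℕ i
    zvec-↑ʳ {ω} {j} i rewrite Fin.splitAt-↑ʳ p q i = pow[a*b]≈[x^b]^a ω (toℕ i) j

  wvec-eigenvector : ∀ {m q ω} → IsPrimitiveRoot (suc m) ω → (cs : Fin (suc m) → Carrier) (D : Matrix q q) →
                     ∀ {j} → 0 < j → j < suc m → IsEigenvector (block (Circ cs) D) (wvec (suc m) q ω j)
  wvec-eigenvector {m} {q} {ω} prim cs D {j} 0<j j<k =
    (Fin.zero ↑ˡ q , λ w₀≈0 → 1≉0 (trans (sym (w-↑ˡ Fin.zero)) w₀≈0)) ,
    eigenvalue x , block-eigen (Circ cs) D w (eigenvalue x) top bottom
    where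
    open RootOfUnity prim using ([ω^j]^k≈1; ω^j≉1)
    open Circulant cs using (eigenvalue; Circ-eigen)
    x = ω ^ j
    w = wvec (suc m) q ω j
    w-↑ˡ : ∀ i → w (i ↑ˡ q) ≈ x ^ toℕ i
    w-↑ˡ = wvec-↑ˡ {suc m} {q} {ω} {j}
    w-↑ʳ : ∀ i → w (suc m ↑ʳ i) ≡ 0#
    w-↑ʳ = wvec-↑ʳ {suc m} {q} {ω} {j}
    top : ∀ i → ∑[ s < suc m ] (Circ cs i s * w (s ↑ˡ q)) + ∑[ s < q ] w (suc m ↑ʳ s) ≈ eigenvalue x * w (i ↑ˡ q)
    top i = begin
      ∑[ s < suc m ] (Circ cs i s * w (s ↑ˡ q)) + ∑[ s < q ] w (suc m ↑ʳ s)
        ≈⟨ +-cong (sum-cong-≋ {suc m} (λ s → *-congˡ {Circ cs i s} (w-↑ˡ s)))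
                  (sum-cong-≋ {q} (λ s → reflexive (w-↑ʳ s))) ⟩
      ∑[ s < suc m ] (Circ cs i s * x ^ toℕ s) + ∑[ s < q ] 0#
        ≈⟨ +-cong (Circ-eigen ([ω^j]^k≈1 j) i) (sum-replicate-zero q) ⟩
      eigenvalue x * x ^ toℕ i + 0#
        ≈⟨ +-identityʳ _ ⟩
      eigenvalue x * x ^ toℕ i
        ≈⟨ *-congˡ (w-↑ˡ i) ⟨
      eigenvalue x * w (i ↑ˡ q)
        ∎
    bottom : ∀ i → ∑[ s < suc m ] w (s ↑ˡ q) + ∑[ s < q ] (D i s * w (suc m ↑ʳ s)) ≈ eigenvalue x * w (suc m ↑ʳ i)
    bottom i = begin
      ∑[ s < suc m ] w (s ↑ˡ q) + ∑[ s < q ] (D i s * w (suc m ↑ʳ s))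
        ≈⟨ +-cong (sum-cong-≋ {suc m} w-↑ˡ)
                  (sum-cong-≋ {q} (λ s → trans (*-congˡ (reflexive (w-↑ʳ s))) (zeroʳ _))) ⟩
      ∑[ s < suc m ] (x ^ toℕ s) + ∑[ s < q ] 0#
        ≈⟨ +-cong (power-sum-≉1 (suc m) ([ω^j]^k≈1 j) (ω^j≉1 0<j j<k)) (sum-replicate-zero q) ⟩
      0# + 0#
        ≈⟨ +-identityʳ 0# ⟩
      0#
        ≈⟨ zeroʳ _ ⟨
      eigenvalue x * 0#
        ≡⟨ ≡.cong (eigenvalue x *_) (w-↑ʳ i) ⟨
      eigenvalue x * w (suc m ↑ʳ i)
        ∎

  zvec-eigenvector : ∀ {p m ω} → IsPrimitiveRoot (suc m) ω → (C : Matrix p p) (ds : Fin (suc m) → Carrier) →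
                     ∀ {j} → 0 < j → j < suc m → IsEigenvector (block C (Circ ds)) (zvec p (suc m) ω j)
  zvec-eigenvector {p} {m} {ω} prim C ds {j} 0<j j<k =
    (p ↑ʳ Fin.zero , λ z₀≈0 → 1≉0 (trans (sym (z-↑ʳ Fin.zero)) z₀≈0)) ,
    eigenvalue x , block-eigen C (Circ ds) z (eigenvalue x) top bottom
    where
    open RootOfUnity prim using ([ω^j]^k≈1; ω^j≉1)
    open Circulant ds using (eigenvalue; Circ-eigen)
    x = ω ^ j
    z = zvec p (suc m) ω j
    z-↑ˡ : ∀ i → z (i ↑ˡ suc m) ≡ 0#
    z-↑ˡ = zvec-↑ˡ {p} {suc m} {ω} {j}
    z-↑ʳ : ∀ i → z (p ↑ʳ i) ≈ x ^ toℕ i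
    z-↑ʳ = zvec-↑ʳ {p} {suc m} {ω} {j}
    top : ∀ i → ∑[ s < p ] (C i s * z (s ↑ˡ suc m)) + ∑[ s < suc m ] z (p ↑ʳ s) ≈ eigenvalue x * z (i ↑ˡ suc m)
    top i = begin
      ∑[ s < p ] (C i s * z (s ↑ˡ suc m)) + ∑[ s < suc m ] z (p ↑ʳ s)
        ≈⟨ +-cong (sum-cong-≋ {p} (λ s → trans (*-congˡ (reflexive (z-↑ˡ s))) (zeroʳ _)))
                  (sum-cong-≋ {suc m} z-↑ʳ) ⟩
      ∑[ s < p ] 0# + ∑[ s < suc m ] (x ^ toℕ s)
        ≈⟨ +-cong (sum-replicate-zero p) (power-sum-≉1 (suc m) ([ω^j]^k≈1 j) (ω^j≉1 0<j j<k)) ⟩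
      0# + 0#
        ≈⟨ +-identityʳ 0# ⟩
      0#
        ≈⟨ zeroʳ _ ⟨
      eigenvalue x * 0#
        ≡⟨ ≡.cong (eigenvalue x *_) (z-↑ˡ i) ⟨
      eigenvalue x * z (i ↑ˡ suc m)
        ∎
    bottom : ∀ i → ∑[ s < p ] z (s ↑ˡ suc m) + ∑[ s < suc m ] (Circ ds i s * z (p ↑ʳ s)) ≈ eigenvalue x * z (p ↑ʳ i)
    bottom i = begin
      ∑[ s < p ] z (s ↑ˡ suc m) + ∑[ s < suc m ] (Circ ds i s * z (p ↑ʳ s))
        ≈⟨ +-cong (sum-cong-≋ {p} (λ s → reflexive (z-↑ˡ s)))
                  (sum-cong-≋ {suc m} (λ s → *-congˡ {Circ ds i s} (z-↑ʳ s))) ⟩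
      ∑[ s < p ] 0# + ∑[ s < suc m ] (Circ ds i s * x ^ toℕ s)
        ≈⟨ +-cong (sum-replicate-zero p) (Circ-eigen ([ω^j]^k≈1 j) i) ⟩
      0# + eigenvalue x * x ^ toℕ i
        ≈⟨ +-identityˡ _ ⟩
      eigenvalue x * x ^ toℕ i
        ≈⟨ *-congˡ (z-↑ʳ i) ⟨
      eigenvalue x * z (p ↑ʳ i)
        ∎

  rep-eigenvector : ∀ {p q} (C : Matrix (suc p) (suc p)) (D : Matrix q q) {Cs Ds x y μ} →
                    (∀ i → ∑[ s < suc p ] C i s ≈ Cs) → (∀ j → ∑[ s < q ] D j s ≈ Ds) →
                    Cs * x + fromℕ q * y ≈ μ * x → fromℕ (suc p) * x + Ds * y ≈ μ * y → x ≉ 0# →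
                    IsEigenvector (block C D) (rep (suc p) q x y)
  rep-eigenvector {p} {q} C D {Cs} {Ds} {x} {y} {μ} ΣC≈Cs ΣD≈Ds top-eq bottom-eq x≉0 =
    (Fin.zero ↑ˡ q , λ v₀≈0 → x≉0 (trans (reflexive (≡.sym (v-↑ˡ Fin.zero))) v₀≈0)) ,
    μ , block-eigen C D v μ top bottom
    where
    v = rep (suc p) q x y
    v-↑ˡ : ∀ i → v (i ↑ˡ q) ≡ x
    v-↑ˡ = rep-↑ˡ {suc p} {q}
    v-↑ʳ : ∀ j → v (suc p ↑ʳ j) ≡ y
    v-↑ʳ = rep-↑ʳ {suc p} {q}
    top : ∀ i → ∑[ s < suc p ] (C i s * v (s ↑ˡ q)) + ∑[ s < q ] v (suc p ↑ʳ s) ≈ μ * v (i ↑ˡ q)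
    top i = begin
      ∑[ s < suc p ] (C i s * v (s ↑ˡ q)) + ∑[ s < q ] v (suc p ↑ʳ s)
        ≡⟨ ≡.cong₂ _+_ (sum-cong-≗ {suc p} (λ s → ≡.cong (C i s *_) (v-↑ˡ s))) (sum-cong-≗ {q} v-↑ʳ) ⟩
      ∑[ s < suc p ] (C i s * x) + ∑[ s < q ] y
        ≈⟨ +-cong (*-distribʳ-sum x (C i)) (sym (sum-const q y)) ⟨
      (∑[ s < suc p ] C i s) * x + fromℕ q * y
        ≈⟨ +-congʳ (*-congʳ (ΣC≈Cs i)) ⟩
      Cs * x + fromℕ q * y
        ≈⟨ top-eq ⟩
      μ * x
        ≡⟨ ≡.cong (μ *_) (v-↑ˡ i) ⟨
      μ * v (i ↑ˡ q)
        ∎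
    bottom : ∀ j → ∑[ s < suc p ] v (s ↑ˡ q) + ∑[ s < q ] (D j s * v (suc p ↑ʳ s)) ≈ μ * v (suc p ↑ʳ j)
    bottom j = begin
      ∑[ s < suc p ] v (s ↑ˡ q) + ∑[ s < q ] (D j s * v (suc p ↑ʳ s))
        ≡⟨ ≡.cong₂ _+_ (sum-cong-≗ {suc p} v-↑ˡ) (sum-cong-≗ {q} (λ s → ≡.cong (D j s *_) (v-↑ʳ s))) ⟩
      ∑[ s < suc p ] x + ∑[ s < q ] (D j s * y)
        ≈⟨ +-cong (sum-const (suc p) x) (sym (*-distribʳ-sum y (D j))) ⟩
      fromℕ (suc p) * x + (∑[ s < q ] D j s) * y
        ≈⟨ +-congˡ (*-congʳ (ΣD≈Ds j)) ⟩
      fromℕ (suc p) * x + Ds * y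
        ≈⟨ bottom-eq ⟩
      μ * y
        ≡⟨ ≡.cong (μ *_) (v-↑ʳ j) ⟨
      μ * v (suc p ↑ʳ j)
        ∎

  eigenvectors-independent : ∀ {m₁ m₂ ω₁ ω₂} →
    IsPrimitiveRoot (suc m₁) ω₁ → IsPrimitiveRoot (suc m₂) ω₂ →
    ∀ {x₁ y₁ x₂ y₂} →
    (∀ a b → a * x₁ + b * x₂ ≈ 0# → a * y₁ + b * y₂ ≈ 0# → (a ≈ 0#) × (b ≈ 0#)) →
    let v₁ = rep (suc m₁) (suc m₂) x₁ y₁
        v₂ = rep (suc m₁) (suc m₂) x₂ y₂
        w = λ (t : Fin m₁) → wvec (suc m₁) (suc m₂) ω₁ (suc (toℕ t))
        z = λ (t : Fin m₂) → zvec (suc m₁) (suc m₂) ω₂ (suc (toℕ t))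
    in
    ∀ (a : Fin m₁ → Carrier) (b : Fin m₂ → Carrier) (α β : Carrier) →
      (∀ r → Σ[ (λ t → a t * w t r) ] + Σ[ (λ t → b t * z t r) ] + α * v₁ r + β * v₂ r ≈ 0#) →
      (∀ t → a t ≈ 0#) × (∀ t → b t ≈ 0#) × (α ≈ 0#) × (β ≈ 0#)
  eigenvectors-independent {m₁} {m₂} {ω₁} {ω₂} prim₁ prim₂ {x₁} {y₁} {x₂} {y₂} indep
                           a b α β combination≈0 =
    f₁≈0 ∘ Fin.suc , f₂≈0 ∘ Fin.suc , indep α β (f₁≈0 Fin.zero) (f₂≈0 Fin.zero)
    where
    k₁ = suc m₁
    k₂ = suc m₂
    f₁ : Fin k₁ → Carrier
    f₁ = (α * x₁ + β * x₂) ∷ a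
    f₂ : Fin k₂ → Carrier
    f₂ = (α * y₁ + β * y₂) ∷ b

    rearrange : ∀ {A B S P P′ Q Q′} → A + B ≈ S → P ≈ P′ → Q ≈ Q′ →
                A + B + P + Q ≈ 0# → (P′ + Q′) * 1# + S ≈ 0#
    rearrange {A} {B} {S} {P} {P′} {Q} {Q′} A+B≈S P≈P′ Q≈Q′ A+B+P+Q≈0 = begin
      (P′ + Q′) * 1# + S  ≈⟨ +-congʳ (*-identityʳ _) ⟩
      (P′ + Q′) + S       ≈⟨ +-comm _ S ⟩
      S + (P′ + Q′)       ≈⟨ +-assoc S P′ Q′ ⟨
      S + P′ + Q′         ≈⟨ +-cong (+-cong A+B≈S P≈P′) Q≈Q′ ⟨
      A + B + P + Q       ≈⟨ A+B+P+Q≈0 ⟩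
      0#                  ∎

    top : ∀ i → ∑[ j < k₁ ] (f₁ j * (ω₁ ^ toℕ i) ^ toℕ j) ≈ 0#
    top i = rearrange (trans (+-cong aw≈ bz≈0) (+-identityʳ _))
                      (*-congˡ (reflexive (rep-↑ˡ {k₁} {k₂} i))) (*-congˡ (reflexive (rep-↑ˡ {k₁} {k₂} i)))
                      (combination≈0 (i ↑ˡ k₂))
      where
      aw≈ : Σ[ (λ t → a t * wvec k₁ k₂ ω₁ (suc (toℕ t)) (i ↑ˡ k₂)) ] ≈
            ∑[ t < m₁ ] (a t * (ω₁ ^ toℕ i) ^ suc (toℕ t))
      aw≈ = Σ≈sum (λ t → a t * wvec k₁ k₂ ω₁ (suc (toℕ t)) (i ↑ˡ k₂)) (λ t → *-congˡ
              (trans (wvec-↑ˡ {k₁} {k₂} {ω₁} {suc (toℕ t)} i) (^-swap ω₁ (suc (toℕ t)) (toℕ i))))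
      bz≈0 : Σ[ (λ t → b t * zvec k₁ k₂ ω₂ (suc (toℕ t)) (i ↑ˡ k₂)) ] ≈ 0#
      bz≈0 = trans (Σ≈sum (λ t → b t * zvec k₁ k₂ ω₂ (suc (toℕ t)) (i ↑ˡ k₂)) (λ t → trans
               (*-congˡ (reflexive (zvec-↑ˡ {k₁} {k₂} {ω₂} {suc (toℕ t)} i))) (zeroʳ (b t))))
               (sum-replicate-zero m₂)

    bottom : ∀ i → ∑[ j < k₂ ] (f₂ j * (ω₂ ^ toℕ i) ^ toℕ j) ≈ 0#
    bottom i = rearrange (trans (+-cong aw≈0 bz≈) (+-identityˡ _))
                         (*-congˡ (reflexive (rep-↑ʳ {k₁} {k₂} i))) (*-congˡ (reflexive (rep-↑ʳ {k₁} {k₂} i)))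
                         (combination≈0 (k₁ ↑ʳ i))
      where
      aw≈0 : Σ[ (λ t → a t * wvec k₁ k₂ ω₁ (suc (toℕ t)) (k₁ ↑ʳ i)) ] ≈ 0#
      aw≈0 = trans (Σ≈sum (λ t → a t * wvec k₁ k₂ ω₁ (suc (toℕ t)) (k₁ ↑ʳ i)) (λ t → trans
               (*-congˡ (reflexive (wvec-↑ʳ {k₁} {k₂} {ω₁} {suc (toℕ t)} i))) (zeroʳ (a t))))
               (sum-replicate-zero m₁)
      bz≈ : Σ[ (λ t → b t * zvec k₁ k₂ ω₂ (suc (toℕ t)) (k₁ ↑ʳ i)) ] ≈
            ∑[ t < m₂ ] (b t * (ω₂ ^ toℕ i) ^ suc (toℕ t))
      bz≈ = Σ≈sum (λ t → b t * zvec k₁ k₂ ω₂ (suc (toℕ t)) (k₁ ↑ʳ i)) (λ t → *-congˡ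
              (trans (zvec-↑ʳ {k₁} {k₂} {ω₂} {suc (toℕ t)} i) (^-swap ω₂ (suc (toℕ t)) (toℕ i))))

    f₁≈0 : ∀ j → f₁ j ≈ 0#
    f₁≈0 = RootOfUnity.dft-injective prim₁ f₁ top

    f₂≈0 : ∀ j → f₂ j ≈ 0#
    f₂≈0 = RootOfUnity.dft-injective prim₂ f₂ bottom

  independent⇒nonzero : ∀ {x₁ y₁ x₂ y₂} →
    (∀ a b → a * x₁ + b * x₂ ≈ 0# → a * y₁ + b * y₂ ≈ 0# → (a ≈ 0#) × (b ≈ 0#)) →
    ¬ ((x₁ ≈ 0#) × (y₁ ≈ 0#)) × ¬ ((x₂ ≈ 0#) × (y₂ ≈ 0#))
  independent⇒nonzero indep =
    (λ (x₁≈0 , y₁≈0) → 1≉0 (proj₁ (indep 1# 0# (only-first x₁≈0) (only-first y₁≈0)))) ,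
    (λ (x₂≈0 , y₂≈0) → 1≉0 (proj₂ (indep 0# 1# (only-second x₂≈0) (only-second y₂≈0))))
    where
    only-first : ∀ {u u′} → u ≈ 0# → 1# * u + 0# * u′ ≈ 0#
    only-first u≈0 = trans (+-cong (trans (*-identityˡ _) u≈0) (zeroˡ _)) (+-identityʳ 0#)
    only-second : ∀ {u u′} → u′ ≈ 0# → 0# * u + 1# * u′ ≈ 0#
    only-second u′≈0 = trans (+-cong (zeroˡ _) (trans (*-identityˡ _) u′≈0)) (+-identityʳ 0#)

  -- An eigenvector needs an explicitly nonzero entry, and ¬ (x ≈ 0 × y ≈ 0) does not
  -- constructively provide one; the first eigen-equation shows that x ≈ 0 would force y ≈ 0.
  eigenvector-head≉0 : ∀ {c k x y μ} → k ≉ 0# → c * x + k * y ≈ μ * x →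
                       ¬ ((x ≈ 0#) × (y ≈ 0#)) → x ≉ 0#
  eigenvector-head≉0 {c} {k} {x} {y} {μ} k≉0 eq nonzero x≈0 = nonzero (x≈0 , x*y≈0⇒y≈0 k≉0 (begin
    k * y           ≈⟨ +-identityˡ _ ⟨
    0# + k * y      ≈⟨ +-congʳ (trans (*-congˡ x≈0) (zeroʳ c)) ⟨
    c * x + k * y   ≈⟨ eq ⟩
    μ * x           ≈⟨ *-congˡ x≈0 ⟩
    μ * 0#          ≈⟨ zeroʳ μ ⟩
    0#              ∎))

proposition2p6 : ∀ {c ℓ} (F : Field c ℓ) →
    let open Field F
        open LinAlg F
    in
    (m₁ m₂ : ℕ) (ω₁ ω₂ : Carrier) →
    IsPrimitiveRoot (suc m₁) ω₁ → IsPrimitiveRoot (suc m₂) ω₂ →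
    (cs : Fin (suc m₁) → Carrier) (ds : Fin (suc m₂) → Carrier) →
    (x₁ y₁ x₂ y₂ : Carrier) →
    let Cs = Σ[ cs ]
        Ds = Σ[ ds ]
        K₁ = fromℕ (suc m₁)
        K₂ = fromℕ (suc m₂)
        A = block (Circ cs) (Circ ds)
        v₁ = rep (suc m₁) (suc m₂) x₁ y₁
        v₂ = rep (suc m₁) (suc m₂) x₂ y₂
        w = λ (t : Fin m₁) → wvec (suc m₁) (suc m₂) ω₁ (suc (toℕ t))
        z = λ (t : Fin m₂) → zvec (suc m₁) (suc m₂) ω₂ (suc (toℕ t))
    in
    -- (x₁,y₁) and (x₂,y₂) are eigenvectors of Ā = (Cs K₂ ; K₁ Ds)
    (∃ λ μ → (Cs * x₁ + K₂ * y₁ ≈ μ * x₁) × (K₁ * x₁ + Ds * y₁ ≈ μ * y₁)) →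
    (∃ λ μ → (Cs * x₂ + K₂ * y₂ ≈ μ * x₂) × (K₁ * x₂ + Ds * y₂ ≈ μ * y₂)) →
    -- ... and they are linearly independent
    (∀ a b → a * x₁ + b * x₂ ≈ 0# → a * y₁ + b * y₂ ≈ 0# → (a ≈ 0#) × (b ≈ 0#)) →
    -- conclusion: all listed vectors are eigenvectors of A ...
    ((∀ t → IsEigenvector A (w t)) × (∀ t → IsEigenvector A (z t)) ×
     IsEigenvector A v₁ × IsEigenvector A v₂) ×
    -- ... and the system is linearly independent
    (∀ (a : Fin m₁ → Carrier) (b : Fin m₂ → Carrier) (α β : Carrier) →
      (∀ r → Σ[ (λ t → a t * w t r) ] + Σ[ (λ t → b t * z t r) ]
               + α * v₁ r + β * v₂ r ≈ 0#) →
      (∀ t → a t ≈ 0#) × (∀ t → b t ≈ 0#) × (α ≈ 0#) × (β ≈ 0#))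
proposition2p6 F m₁ m₂ ω₁ ω₂ prim₁ prim₂ cs ds x₁ y₁ x₂ y₂
               (_ , top₁ , bottom₁) (_ , top₂ , bottom₂) indep =
  ( (λ t → wvec-eigenvector prim₁ cs (Circ ds) (s≤s z≤n) (s≤s (Fin.toℕ<n t)))
  , (λ t → zvec-eigenvector prim₂ (Circ cs) ds (s≤s z≤n) (s≤s (Fin.toℕ<n t)))
  , eigenvector-rep top₁ bottom₁ (proj₁ (independent⇒nonzero indep))
  , eigenvector-rep top₂ bottom₂ (proj₂ (independent⇒nonzero indep)) )
  , eigenvectors-independent prim₁ prim₂ indep
  where
  open Field F
  open LinAlg F
  open BlockCirculant F

  eigenvector-rep : ∀ {x y μ} →
    Σ[ cs ] * x + fromℕ (suc m₂) * y ≈ μ * x → fromℕ (suc m₁) * x + Σ[ ds ] * y ≈ μ * y →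
    ¬ ((x ≈ 0#) × (y ≈ 0#)) → IsEigenvector (block (Circ cs) (Circ ds)) (rep (suc m₁) (suc m₂) x y)
  eigenvector-rep top bottom nonzero =
    rep-eigenvector (Circ cs) (Circ ds) (Circulant.Circ-row-sum cs) (Circulant.Circ-row-sum ds) top bottom
                    (eigenvector-head≉0 (RootOfUnity.K≉0 prim₂) top nonzero)
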